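{- With step-down arguments as defined in the context (all ordinals below $\varepsilon_0$): (a) For every ordinal $\alpha$ there is a step-down argument $s\vdash\alpha\leq_0\alpha$. (b) For every $\alpha<\varepsilon_0$ there is a step-down argument $s\vdash 0\leq_0\alpha$; if $\alpha\geq1$ there is one with $s\vdash 1\leq_0\alpha$; if $\alpha\geq 2$ there is one with $s\vdash 2\leq_1\alpha$. (c) Let $\alpha,\beta<\omega^2$. If there is a step-down argument for $\alpha+1\leq_k\beta$, then there are step-down arguments for $3^\alpha\cdot2+1\leq_{3^{k+1}}3^\beta$ and for $3^\alpha+1\leq_{3^{k+1}}3^\beta$. If there is a step-down argument for $\alpha+2\leq_k\beta$, then there is one for $3^\alpha+2\leq_{3^{k+1}}3^\beta$. (d) Let $k\geq2$. If there is a step-down argument for $\alpha+1\leq_k\beta$, then there are step-down arguments for $\omega^\alpha\cdot2+1\leq_k\omega^\beta$ and for $\omega^\alpha+1\leq_k\omega^\beta$. If there is a step-down argument for $\alpha+2\leq_k\beta$, then there is one for $\omega^\alpha+2\leq_k\omega^\beta$.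
   Context: Ordinals below $\varepsilon_0$ are given in Cantor normal form; for $p,q\in\mathbb N$, $3^{\omega\cdot p+q}:=\omega^p\cdot 3^q$. Fundamental sequences: $\{0\}(n)=0$, $\{\alpha+1\}(n)=\alpha$; for limit $\alpha=\gamma+\omega^{\delta}$ (Cantor normal form, $\delta>0$), $\{\alpha\}(n)=\gamma+\omega^{\delta'}\cdot(n+1)$ if $\delta=\delta'+1$, and $\{\alpha\}(n)=\gamma+\omega^{\{\delta\}(n)}$ if $\delta$ is a limit. $\alpha$ meshes with $\gamma$ if $\alpha=0$ or $\gamma<\omega^{\alpha_0+1}$ with $\alpha_0$ the smallest exponent in the Cantor normal form of $\alpha$. Step-down arguments are finite terms with a top and a bottom, generated by: (i) $\mathrm{fund}(m)$ with top $\beta$, bottom $\{\beta\}(m)$; (ii) $s*t$ with top of $t$, bottom of $s$, when top of $s$ equals bottom of $t$; (iii) $\alpha+s$ with top $\alpha+\mathrm{top}(s)$, bottom $\alpha+\mathrm{bot}(s)$, when $\alpha$ meshes with $\mathrm{top}(s)$; (iv) $\omega^s$ with top $\omega^{\mathrm{top}(s)}$, bottom $\omega^{\mathrm{bot}(s)}$. The base of $s$ is the maximal $m$ with $\mathrm{fund}(m)$ occurring in $s$. "$s\vdash\alpha\leq_k\beta$" (a step-down argument for $\alpha\leq_k\beta$) means top $\beta$, bottom $\alpha$, base $\leq k$. -}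

module Defs where

open import Data.Nat using (ℕ; zero; suc; _⊔_; _≤_; _^_)
open import Data.Maybe using (Maybe; just; nothing)
open import Data.Product using (Σ)
open import Data.Unit using (⊤)
open import Relation.Binary.PropositionalEquality using (_≡_; _≢_)
open import Relation.Nullary using (¬_)

-- Ordinals below ε₀ as Cantor-normal-form terms
--   ω^ a + b  stands for  ω^a + b
-- A term denotes an ordinal < ε₀ when it satisfies IsNF (exponents
-- weakly decreasing, recursively).  On normal terms, syntactic equality
-- is ordinal equality (uniqueness of Cantor normal form).

data Ord : Set where
  𝟎     : Ord
  ω^_+_ : Ord → Ord → Ord

infixr 30 ω^_+_

data Cmp : Set where
  lt eq gt : Cmp

-- comparison (correct on normal forms): lexicographic on CNF
cmp : Ord → Ord → Cmp
cmp 𝟎 𝟎 = eq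
cmp 𝟎 (ω^ _ + _) = lt
cmp (ω^ _ + _) 𝟎 = gt
cmp (ω^ a + b) (ω^ c + d) with cmp a c
... | lt = lt
... | eq = cmp b d
... | gt = gt

_<O_ : Ord → Ord → Set
a <O b = cmp a b ≡ lt

_≤O_ : Ord → Ord → Set
a ≤O b = ¬ (b <O a)

LeadLe : Ord → Ord → Set
LeadLe 𝟎 a = ⊤
LeadLe (ω^ c + d) a = c ≤O a

data IsNF : Ord → Set where
  nf𝟎 : IsNF 𝟎
  nfω : ∀ {a b} → IsNF a → IsNF b → LeadLe b a → IsNF (ω^ a + b)

ωexp : Ord → Ord
ωexp a = ω^ a + 𝟎

one : Ord
one = ω^ 𝟎 + 𝟎

two : Ord
two = ω^ 𝟎 + one

natO : ℕ → Ord
natO zero = 𝟎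
natO (suc n) = ω^ 𝟎 + natO n

infixl 20 _⊕_
_⊕_ : Ord → Ord → Ord
𝟎 ⊕ b = b
(ω^ a + a') ⊕ 𝟎 = ω^ a + a'
(ω^ a + a') ⊕ (ω^ c + d) with cmp a c
... | lt = ω^ c + d
... | eq = ω^ a + (a' ⊕ (ω^ c + d))
... | gt = ω^ a + (a' ⊕ (ω^ c + d))

ωmul : Ord → ℕ → Ord
ωmul d zero = 𝟎
ωmul d (suc k) = ω^ d + ωmul d k

predO : Ord → Maybe Ord
predO 𝟎 = nothing
predO (ω^ 𝟎 + 𝟎) = just 𝟎
predO (ω^ (ω^ _ + _) + 𝟎) = nothing
predO (ω^ a + (ω^ c + d)) with predO (ω^ c + d)
... | just p = just (ω^ a + p)
... | nothing = nothing

mutual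
  fs : Ord → ℕ → Ord
  fs 𝟎 n = 𝟎
  fs (ω^ 𝟎 + 𝟎) n = 𝟎
  fs (ω^ (ω^ a + b) + 𝟎) n = fsLast (ω^ a + b) (predO (ω^ a + b)) n
  fs (ω^ a + (ω^ c + d)) n = ω^ a + fs (ω^ c + d) n

  -- {ω^δ}(n) for δ > 0, given the predecessor of δ if δ is a successor
  fsLast : Ord → Maybe Ord → ℕ → Ord
  fsLast δ (just δ') n = ωmul δ' (suc n)
  fsLast δ nothing n = ωexp (fs δ n)

minExp : Ord → Ord
minExp 𝟎 = 𝟎
minExp (ω^ a + 𝟎) = a
minExp (ω^ a + (ω^ c + d)) = minExp (ω^ c + d)

Meshes : Ord → Ord → Set
Meshes 𝟎 γ = ⊤
Meshes (ω^ a + b) γ = γ <O ωexp (minExp (ω^ a + b) ⊕ one)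

-- Step-down arguments, indexed by bottom and top:  Arg bottom top

data Arg : Ord → Ord → Set where
  fund  : (m : ℕ) (β : Ord) → IsNF β → Arg (fs β m) β
  _∗_   : ∀ {a b c} → Arg a b → Arg b c → Arg a c
  plus  : ∀ {a b} (α : Ord) → IsNF α → Meshes α b → Arg a b → Arg (α ⊕ a) (α ⊕ b)
  omega : ∀ {a b} → Arg a b → Arg (ωexp a) (ωexp b)

base : ∀ {a b} → Arg a b → ℕ
base (fund m _ _) = m
base (s ∗ t) = base s ⊔ base t
base (plus _ _ _ s) = base s
base (omega s) = base s

infix 5 _⊢≤[_]_
_⊢≤[_]_ : Ord → ℕ → Ord → Set
α ⊢≤[ k ] β = Σ (Arg α β) (λ s → base s ≤ k)

-- ordinals below ω² : ω·p + q ;  3^(ω·p+q) = ω^p · 3^q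

ωpq : ℕ → ℕ → Ord
ωpq p q = ωmul one p ⊕ natO q

3^ : ℕ → ℕ → Ord
3^ p q = ωmul (natO p) (3 ^ q)

×2 : Ord → Ord
×2 x = x ⊕ x

-- Everything reduces to a
-- handful of building blocks: the fundamental step  ω^α·(m+1) ≤_m ω^(α+1),
-- lifting an argument under ω^_ or behind a meshing prefix, the argument
-- 0 ≤_0 α (by recursion on the Cantor normal form), and "appending one term"
-- ω^e·n + x ≤ ω^e·(n+j) whenever x ≤ ω^e·j.
--
-- Part (c) additionally needs to know what the hypothesis α+1 ≤_k β says when
-- β < ω².  The key fact (soundness) is that every step-down argument of base
-- ≤ k with top ω·p'+q' has bottom ω·p+q with  p = p' ∧ q ≤ q'  or  p < p' ∧ q ≤ k+1;
-- the only nontrivial case is a prefix α + s, where meshing forbids α from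
-- absorbing the tail.  With this description of the hypothesis the targets
-- ω^p·3^q·c + j ≤ ω^p'·3^q' are reached by appending, then climbing either
-- inside the block ω^p (same p) or by one fundamental step of base ≤ 3^(k+1)
-- into ω^(p+1) ≤ ω^p' (larger p').
module Submission where

open import Defs
open import Data.Nat using (ℕ; zero; suc; _≤_; _<_; _^_; _+_; _∸_; z≤n; s≤s)
open import Data.Nat.Properties
open import Data.Product using (_×_; _,_; Σ; proj₁; proj₂)
open import Data.Sum using (_⊎_; inj₁; inj₂)
open import Data.Maybe using (just)
open import Data.Unit using (tt)
open import Data.Empty using (⊥-elim)
open import Relation.Nullary using (¬_)
open import Relation.Binary.PropositionalEquality

lexCmp : Cmp → Ord → Ord → Cmp
lexCmp lt _ _ = lt
lexCmp eq b d = cmp b d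
lexCmp gt _ _ = gt

cmp-ω : ∀ a b c d → cmp (ω^ a + b) (ω^ c + d) ≡ lexCmp (cmp a c) b d
cmp-ω a b c d with cmp a c
... | lt = refl
... | eq = refl
... | gt = refl

cmp-refl : ∀ a → cmp a a ≡ eq
cmp-refl 𝟎 = refl
cmp-refl (ω^ a + b) rewrite cmp-ω a b a b | cmp-refl a = cmp-refl b

cmp-eq⇒≡ : ∀ a b → cmp a b ≡ eq → a ≡ b
cmp-eq⇒≡ 𝟎 𝟎 _ = refl
cmp-eq⇒≡ (ω^ a + b) (ω^ c + d) h = go (cmp a c) refl (trans (sym (cmp-ω a b c d)) h)
  where
  go : ∀ r → cmp a c ≡ r → lexCmp r b d ≡ eq → ω^ a + b ≡ ω^ c + d
  go eq e h′ = cong₂ ω^_+_ (cmp-eq⇒≡ a c e) (cmp-eq⇒≡ b d h′)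

flipCmp : Cmp → Cmp
flipCmp lt = gt
flipCmp eq = eq
flipCmp gt = lt

cmp-flip : ∀ a b → cmp b a ≡ flipCmp (cmp a b)
cmp-flip 𝟎 𝟎 = refl
cmp-flip 𝟎 (ω^ _ + _) = refl
cmp-flip (ω^ _ + _) 𝟎 = refl
cmp-flip (ω^ a + b) (ω^ c + d)
  rewrite cmp-ω a b c d | cmp-ω c d a b | cmp-flip a c = go (cmp a c)
  where
  go : ∀ r → lexCmp (flipCmp r) d b ≡ flipCmp (lexCmp r b d)
  go lt = refl
  go eq = cmp-flip b d
  go gt = refl

<O-trans : ∀ a b c → a <O b → b <O c → a <O c
<O-trans 𝟎 (ω^ _ + _) (ω^ _ + _) _ _ = refl
<O-trans (ω^ a + a′) (ω^ b + b′) (ω^ c + c′) h₁ h₂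
  rewrite cmp-ω a a′ b b′ | cmp-ω b b′ c c′ | cmp-ω a a′ c c′ =
  go (cmp a b) (cmp b c) refl refl h₁ h₂
  where
  go : ∀ r₁ r₂ → cmp a b ≡ r₁ → cmp b c ≡ r₂ →
       lexCmp r₁ a′ b′ ≡ lt → lexCmp r₂ b′ c′ ≡ lt → lexCmp (cmp a c) a′ c′ ≡ lt
  go lt lt e₁ e₂ _ _ rewrite <O-trans a b c e₁ e₂ = refl
  go lt eq e₁ e₂ _ _ rewrite sym (cmp-eq⇒≡ b c e₂) | e₁ = refl
  go eq lt e₁ e₂ _ _ rewrite cmp-eq⇒≡ a b e₁ | e₂ = refl
  go eq eq e₁ e₂ k₁ k₂ rewrite cmp-eq⇒≡ a b e₁ | cmp-eq⇒≡ b c e₂ | cmp-refl c =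
    <O-trans a′ b′ c′ k₁ k₂

-- mixed transitivity, needed to see that ω^a meshes with the tail of ω^a + b
≤O-<O-trans : ∀ {a c e} → c ≤O a → a <O e → c <O e
≤O-<O-trans {a} {c} {e} c≤a a<e = go (cmp a c) refl c≤a
  where
  go : ∀ r → cmp a c ≡ r → ¬ (r ≡ lt) → c <O e
  go lt _ r≢lt = ⊥-elim (r≢lt refl)
  go eq a≡c _ rewrite sym (cmp-eq⇒≡ a c a≡c) = a<e
  go gt a>c _ = <O-trans c a e (trans (cmp-flip a c) (cong flipCmp a>c)) a<e

≮𝟎 : ∀ a → ¬ (a <O 𝟎)
≮𝟎 𝟎 ()
≮𝟎 (ω^ _ + _) ()

≤O-𝟎 : ∀ c → c ≤O 𝟎 → c ≡ 𝟎
≤O-𝟎 𝟎 _ = refl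
≤O-𝟎 (ω^ _ + _) c≤𝟎 = ⊥-elim (c≤𝟎 refl)

consAdd : Cmp → Ord → Ord → Ord → Ord → Ord
consAdd lt a a′ c d = ω^ c + d
consAdd eq a a′ c d = ω^ a + (a′ ⊕ (ω^ c + d))
consAdd gt a a′ c d = ω^ a + (a′ ⊕ (ω^ c + d))

⊕-ω : ∀ a a′ c d → (ω^ a + a′) ⊕ (ω^ c + d) ≡ consAdd (cmp a c) a a′ c d
⊕-ω a a′ c d with cmp a c
... | lt = refl
... | eq = refl
... | gt = refl

⊕-identityʳ : ∀ a → a ⊕ 𝟎 ≡ a
⊕-identityʳ 𝟎 = refl
⊕-identityʳ (ω^ _ + _) = refl

succ : Ord → Ord
succ 𝟎 = one
succ (ω^ a + b) = ω^ a + succ b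

⊕-one : ∀ a → a ⊕ one ≡ succ a
⊕-one 𝟎 = refl
⊕-one (ω^ 𝟎 + b) = cong (ω^ 𝟎 +_) (⊕-one b)
⊕-one (ω^ (ω^ _ + _) + b) = cong (ω^ _ +_) (⊕-one b)

⊕-two : ∀ a → a ⊕ two ≡ succ (succ a)
⊕-two 𝟎 = refl
⊕-two (ω^ 𝟎 + b) = cong (ω^ 𝟎 +_) (⊕-two b)
⊕-two (ω^ (ω^ _ + _) + b) = cong (ω^ _ +_) (⊕-two b)

<O-succ : ∀ a → a <O succ a
<O-succ 𝟎 = refl
<O-succ (ω^ a + b) rewrite cmp-ω a b a (succ b) | cmp-refl a = <O-succ b

nf-succ : ∀ {x} → IsNF x → IsNF (succ x)
nf-succ nf𝟎 = nfω nf𝟎 nf𝟎 tt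
nf-succ (nfω {a} {𝟎} na nb _) = nfω na (nf-succ nb) (≮𝟎 a)
nf-succ (nfω {a} {ω^ _ + _} na nb l) = nfω na (nf-succ nb) l

predO-succ : ∀ x → predO (succ x) ≡ just x
predO-succ 𝟎 = refl
predO-succ (ω^ 𝟎 + 𝟎) = refl
predO-succ (ω^ (ω^ _ + _) + 𝟎) = refl
predO-succ (ω^ 𝟎 + (ω^ c + d)) rewrite predO-succ (ω^ c + d) = refl
predO-succ (ω^ (ω^ _ + _) + (ω^ c + d)) rewrite predO-succ (ω^ c + d) = refl

fs-ω^succ : ∀ x m → fs (ωexp (succ x)) m ≡ ωmul x (suc m)
fs-ω^succ 𝟎 m = refl
fs-ω^succ (ω^ a + b) m rewrite predO-succ (ω^ a + b) = refl

ωmul-+ : ∀ e n j → ωmul e n ⊕ ωmul e j ≡ ωmul e (n + j)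
ωmul-+ e zero j = refl
ωmul-+ e (suc n) zero rewrite +-identityʳ n = refl
ωmul-+ e (suc n) (suc j) rewrite ⊕-ω e (ωmul e n) e (ωmul e j) | cmp-refl e =
  cong (ω^ e +_) (ωmul-+ e n (suc j))

nf-ωmul : ∀ {e} → IsNF e → ∀ n → IsNF (ωmul e n)
nf-ωmul ne zero = nf𝟎
nf-ωmul ne (suc zero) = nfω ne nf𝟎 tt
nf-ωmul {e} ne (suc (suc n)) =
  nfω ne (nf-ωmul ne (suc n)) (λ e<e → lt≢eq (trans (sym e<e) (cmp-refl e)))
  where
  lt≢eq : ¬ (lt ≡ eq)
  lt≢eq ()

minExp-ωmul : ∀ e n → minExp (ωmul e (suc n)) ≡ e
minExp-ωmul e zero = refl
minExp-ωmul e (suc n) = minExp-ωmul e n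

ωmul-𝟎 : ∀ n → ωmul 𝟎 n ≡ natO n
ωmul-𝟎 zero = refl
ωmul-𝟎 (suc n) = cong (ω^ 𝟎 +_) (ωmul-𝟎 n)

nf-natO : ∀ n → IsNF (natO n)
nf-natO n = subst IsNF (ωmul-𝟎 n) (nf-ωmul nf𝟎 n)

nf-one : IsNF one
nf-one = nf-natO 1

nf-ωexp : ∀ {a} → IsNF a → IsNF (ωexp a)
nf-ωexp na = nfω na nf𝟎 tt

nf-finite : ∀ {b} → IsNF (ω^ 𝟎 + b) → Σ ℕ λ n → ω^ 𝟎 + b ≡ natO (suc n)
nf-finite {𝟎} _ = 0 , refl
nf-finite {ω^ c + d} (nfω _ nb l) with ≤O-𝟎 c l
... | refl with nf-finite nb
...   | n , e = suc n , cong (ω^ 𝟎 +_) e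

minExp-natO : ∀ n → minExp (natO (suc n)) ≡ 𝟎
minExp-natO zero = refl
minExp-natO (suc n) = minExp-natO n

-- Meshing.

meshes-𝟎 : ∀ α → Meshes α 𝟎
meshes-𝟎 𝟎 = tt
meshes-𝟎 (ω^ _ + _) = refl

meshes-tail : ∀ {a α′ b} → Meshes (ω^ a + α′) b → Meshes α′ b
meshes-tail {α′ = 𝟎} _ = tt
meshes-tail {α′ = ω^ _ + _} m = m

ωmul-<O : ∀ e d → ωmul e d <O ωexp (e ⊕ one)
ωmul-<O e zero = refl
ωmul-<O e (suc d) rewrite cmp-ω e (ωmul e d) (e ⊕ one) 𝟎 | ⊕-one e | <O-succ e = refl

meshes-ωmul : ∀ e n j → Meshes (ωmul e n) (ωmul e j)
meshes-ωmul e zero j = tt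
meshes-ωmul e (suc n) j =
  subst (λ z → ωmul e j <O ωexp (z ⊕ one)) (sym (minExp-ωmul e n)) (ωmul-<O e j)

meshes-head : ∀ a b → LeadLe b a → Meshes (ωexp a) b
meshes-head a 𝟎 _ = refl
meshes-head a (ω^ c + d) c≤a rewrite cmp-ω c d (a ⊕ one) 𝟎 | ⊕-one a =
  cong (λ r → lexCmp r d 𝟎) (≤O-<O-trans {a} {c} {succ a} c≤a (<O-succ a))

⊕-head : ∀ a b → LeadLe b a → ωexp a ⊕ b ≡ ω^ a + b
⊕-head a 𝟎 _ = refl
⊕-head a (ω^ c + d) c≤a rewrite ⊕-ω a 𝟎 c d = go (cmp a c) refl
  where
  go : ∀ r → cmp a c ≡ r → consAdd r a 𝟎 c d ≡ ω^ a + (ω^ c + d)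
  go lt a<c = ⊥-elim (c≤a a<c)
  go eq _ = refl
  go gt _ = refl

infixr 4 _⨾_
_⨾_ : ∀ {x y z k} → x ⊢≤[ k ] y → y ⊢≤[ k ] z → x ⊢≤[ k ] z
(s , bs) ⨾ (t , bt) = s ∗ t , ⊔-lub bs bt

weaken : ∀ {x y k k′} → k ≤ k′ → x ⊢≤[ k ] y → x ⊢≤[ k′ ] y
weaken k≤k′ (s , bs) = s , ≤-trans bs k≤k′

fund≤ : ∀ m β → IsNF β → fs β m ⊢≤[ m ] β
fund≤ m β nβ = fund m β nβ , ≤-refl

plus≤ : ∀ {a b k} α → IsNF α → Meshes α b → a ⊢≤[ k ] b → α ⊕ a ⊢≤[ k ] α ⊕ b
plus≤ α nα m (s , bs) = plus α nα m s , bs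

omega≤ : ∀ {a b k} → a ⊢≤[ k ] b → ωexp a ⊢≤[ k ] ωexp b
omega≤ (s , bs) = omega s , bs

≡-bot : ∀ {x x′ y k} → x ≡ x′ → x ⊢≤[ k ] y → x′ ⊢≤[ k ] y
≡-bot refl d = d

≡-top : ∀ {x y y′ k} → y ≡ y′ → x ⊢≤[ k ] y → x ⊢≤[ k ] y′
≡-top refl d = d

plus-head : ∀ {a b x k} → IsNF (ω^ a + b) → x ⊢≤[ k ] b → ωexp a ⊕ x ⊢≤[ k ] ω^ a + b
plus-head {a} {b} (nfω na _ l) d =
  ≡-top (⊕-head a b l) (plus≤ (ωexp a) (nf-ωexp na) (meshes-head a b l) d)

-- Part (a) and part (b).

-- (a): the argument α + fund(0) at 0
refl≤ : ∀ α → IsNF α → α ⊢≤[ 0 ] α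
refl≤ α nα = ≡-bot (⊕-identityʳ α) (≡-top (⊕-identityʳ α) (plus≤ α nα (meshes-𝟎 α) (fund≤ 0 𝟎 nf𝟎)))

-- (b), first claim: descend through every term of the normal form, using
-- ω^a ≥ ω^0 = 1 ≥ {1}(0) = 0 for the leading term
mutual
  zero≤ : ∀ α → IsNF α → 𝟎 ⊢≤[ 0 ] α
  zero≤ 𝟎 _ = fund≤ 0 𝟎 nf𝟎
  zero≤ (ω^ a + b) nf@(nfω na nb _) = zero≤ω^ a na ⨾ plus-head nf (zero≤ b nb)

  zero≤ω^ : ∀ a → IsNF a → 𝟎 ⊢≤[ 0 ] ωexp a
  zero≤ω^ a na = fund≤ 0 one nf-one ⨾ omega≤ (zero≤ a na)

one≤ω^ : ∀ a → IsNF a → one ⊢≤[ 0 ] ωexp a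
one≤ω^ a na = omega≤ (zero≤ a na)

one≤ : ∀ α → IsNF α → one ≤O α → one ⊢≤[ 0 ] α
one≤ 𝟎 _ 1≤𝟎 = ⊥-elim (1≤𝟎 refl)
one≤ (ω^ a + b) nf@(nfω na nb _) _ = one≤ω^ a na ⨾ plus-head nf (zero≤ b nb)

natO≤ : ∀ {m n} → m ≤ n → natO m ⊢≤[ 0 ] natO n
natO≤ {zero} {n} _ = zero≤ (natO n) (nf-natO n)
natO≤ {suc m} {suc n} (s≤s m≤n) =
  ≡-bot (one-⊕ m) (≡-top (one-⊕ n) (plus≤ one nf-one (meshes-one n) (natO≤ m≤n)))
  where
  one-⊕ : ∀ n → one ⊕ natO n ≡ natO (suc n)
  one-⊕ zero = refl
  one-⊕ (suc _) = refl
  meshes-one : ∀ n → Meshes one (natO n)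
  meshes-one zero = refl
  meshes-one (suc _) = refl

-- (b), third claim: finite α by natO≤, infinite α via  2 = {ω}(1)
two≤ : ∀ α → IsNF α → two ≤O α → two ⊢≤[ 1 ] α
two≤ 𝟎 _ 2≤𝟎 = ⊥-elim (2≤𝟎 refl)
two≤ (ω^ 𝟎 + b) nf 2≤α with nf-finite nf
... | zero , refl = ⊥-elim (2≤α refl)
... | suc n , e = weaken z≤n (≡-top (sym e) (natO≤ (s≤s (s≤s z≤n))))
two≤ (ω^ (ω^ x + y) + b) nf@(nfω na nb _) _ =
  fund≤ 1 (ωexp one) (nf-ωexp nf-one)
  ⨾ weaken z≤n (omega≤ (one≤ (ω^ x + y) na (one≤Oω x y)) ⨾ plus-head nf (zero≤ b nb))
  where
  one≤Oω : ∀ x y → one ≤O (ω^ x + y)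
  one≤Oω 𝟎 y = ≮𝟎 y
  one≤Oω (ω^ _ + _) _ ()

-- Appending to and climbing along multiples ω^e·n.

ωmul-append : ∀ {x k} e n j → IsNF e → x ⊢≤[ k ] ωmul e j → ωmul e n ⊕ x ⊢≤[ k ] ωmul e (n + j)
ωmul-append e n j ne d =
  ≡-top (ωmul-+ e n j) (plus≤ (ωmul e n) (nf-ωmul ne n) (meshes-ωmul e n j) d)

ωmul≤ : ∀ e {n N} → IsNF e → n ≤ N → ωmul e n ⊢≤[ 0 ] ωmul e N
ωmul≤ e {n} {N} ne n≤N =
  ≡-top (cong (ωmul e) (m+[n∸m]≡n n≤N))
    (≡-bot (⊕-identityʳ (ωmul e n)) (ωmul-append e n (N ∸ n) ne (zero≤ _ (nf-ωmul ne (N ∸ n)))))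

ωmul-+one : ∀ e n → IsNF e → ωmul e n ⊕ one ⊢≤[ 0 ] ωmul e (suc n)
ωmul-+one e n ne = ≡-top (cong (ωmul e) (+-comm n 1)) (ωmul-append e n 1 ne (one≤ω^ e ne))

ωmul-+two : ∀ e n → IsNF e → ωmul e n ⊕ two ⊢≤[ 1 ] ωmul e (suc (suc n))
ωmul-+two e n ne =
  ≡-top (cong (ωmul e) (+-comm n 2))
        (ωmul-append e n 2 ne (two≤ (ωmul e 2) (nf-ωmul ne 2) (two≤ωmul e)))
  where
  two≤ωmul : ∀ e → two ≤O ωmul e 2
  two≤ωmul 𝟎 ()
  two≤ωmul (ω^ _ + _) ()

fund-ω^succ : ∀ e m → IsNF e → ωmul e (suc m) ⊢≤[ m ] ωexp (succ e)
fund-ω^succ e m ne = ≡-bot (fs-ω^succ e m) (fund≤ m (ωexp (succ e)) (nf-ωexp (nf-succ ne)))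

-- Part (d).

-- ω^α·n + 1 ≤_0 ω^α·(n+1) ≤_n ω^(α+1) ≤_k ω^β
ω^·n+one≤ : ∀ {α β k} n → IsNF α → n ≤ k → α ⊕ one ⊢≤[ k ] β → ωmul α n ⊕ one ⊢≤[ k ] ωexp β
ω^·n+one≤ {α} n nα n≤k d =
  weaken z≤n (ωmul-+one α n nα)
  ⨾ weaken n≤k (fund-ω^succ α n nα)
  ⨾ ≡-bot (cong ωexp (⊕-one α)) (omega≤ d)

-- ω^α + 2 ≤_1 ω^α·3 ≤_2 ω^(α+1) = {ω^(α+2)}(0) ≤_k ω^β
ω^+two≤ : ∀ {α β k} → IsNF α → 2 ≤ k → α ⊕ two ⊢≤[ k ] β → ωexp α ⊕ two ⊢≤[ k ] ωexp β
ω^+two≤ {α} nα 2≤k d =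
  weaken (≤-trans (s≤s z≤n) 2≤k) (ωmul-+two α 1 nα)
  ⨾ weaken 2≤k (fund-ω^succ α 2 nα)
  ⨾ weaken z≤n (fund-ω^succ (succ α) 0 (nf-succ nα))
  ⨾ ≡-bot (cong ωexp (⊕-two α)) (omega≤ d)

-- Ordinals below ω².

cnf² : ℕ → ℕ → Ord
cnf² zero q = natO q
cnf² (suc p) q = ω^ one + cnf² p q

ωpq≡cnf² : ∀ p q → ωpq p q ≡ cnf² p q
ωpq≡cnf² zero q = refl
ωpq≡cnf² (suc p) zero = cong (ω^ one +_) (trans (sym (⊕-identityʳ _)) (ωpq≡cnf² p 0))
ωpq≡cnf² (suc p) (suc q) = cong (ω^ one +_) (ωpq≡cnf² p (suc q))

succ-cnf² : ∀ p q → succ (cnf² p q) ≡ cnf² p (suc q)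
succ-cnf² zero zero = refl
succ-cnf² zero (suc q) = cong (ω^ 𝟎 +_) (succ-cnf² zero q)
succ-cnf² (suc p) q = cong (ω^ one +_) (succ-cnf² p q)

ω-injective : ∀ {a b c d} → ω^ a + b ≡ ω^ c + d → a ≡ c × b ≡ d
ω-injective refl = refl , refl

natO-injective : ∀ {q q′} → natO q ≡ natO q′ → q ≡ q′
natO-injective {zero} {zero} _ = refl
natO-injective {suc q} {suc q′} e = cong suc (natO-injective (proj₂ (ω-injective e)))

cnf²-injective : ∀ {p q p′ q′} → cnf² p q ≡ cnf² p′ q′ → p ≡ p′ × q ≡ q′
cnf²-injective {zero} {_} {zero} e = refl , natO-injective e
cnf²-injective {zero} {suc _} {suc _} e with proj₁ (ω-injective e)
... | ()
cnf²-injective {suc _} {_} {zero} {suc _} e with proj₁ (ω-injective e)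
... | ()
cnf²-injective {suc p} {_} {suc p′} e with cnf²-injective {p} {_} {p′} (proj₂ (ω-injective e))
... | refl , refl = refl , refl

data ConsView : Ord → Ord → ℕ → ℕ → Set where
  ω-term : ∀ {X p q} → X ≡ cnf² p q → ConsView one X (suc p) q
  1-term : ∀ {X q} → X ≡ natO q → ConsView 𝟎 X 0 (suc q)

consView : ∀ {e X p′ q′} → ω^ e + X ≡ cnf² p′ q′ → ConsView e X p′ q′
consView {p′ = zero} {suc q′} e with ω-injective e
... | refl , X≡ = 1-term X≡
consView {p′ = suc p′} e with ω-injective e
... | refl , X≡ = ω-term X≡

fs-cnf²-succ : ∀ p q m → fs (cnf² p (suc q)) m ≡ cnf² p q
fs-cnf²-succ zero zero m = refl
fs-cnf²-succ zero (suc q) m = cong (ω^ 𝟎 +_) (fs-cnf²-succ zero q m)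
fs-cnf²-succ (suc zero) q m = cong (ω^ one +_) (fs-cnf²-succ zero q m)
fs-cnf²-succ (suc (suc p)) q m = cong (ω^ one +_) (fs-cnf²-succ (suc p) q m)

fs-cnf²-limit : ∀ p m → fs (cnf² (suc p) 0) m ≡ cnf² p (suc m)
fs-cnf²-limit zero m = ωmul-𝟎 (suc m)
fs-cnf²-limit (suc p) m = cong (ω^ one +_) (fs-cnf²-limit p m)

cnf²-+ : ∀ pα qα p q → (qα ≡ 0 ⊎ p ≡ 0) → cnf² pα qα ⊕ cnf² p q ≡ cnf² (pα + p) (qα + q)
cnf²-+ zero _ _ _ (inj₁ refl) = refl
cnf²-+ (suc pα) _ zero zero (inj₁ refl) rewrite +-identityʳ pα = refl
cnf²-+ (suc pα) _ zero (suc q) (inj₁ refl) = cong (ω^ one +_) (cnf²-+ pα 0 0 (suc q) (inj₁ refl))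
cnf²-+ (suc pα) _ (suc p) q (inj₁ refl) = cong (ω^ one +_) (cnf²-+ pα 0 (suc p) q (inj₁ refl))
cnf²-+ pα qα _ zero (inj₂ refl)
  rewrite ⊕-identityʳ (cnf² pα qα) | +-identityʳ pα | +-identityʳ qα = refl
cnf²-+ zero zero _ (suc q) (inj₂ refl) = refl
cnf²-+ zero (suc qα) _ (suc q) (inj₂ refl) = cong (ω^ 𝟎 +_) (cnf²-+ zero qα 0 (suc q) (inj₂ refl))
cnf²-+ (suc pα) qα _ (suc q) (inj₂ refl) =
  cong (ω^ one +_) (cnf²-+ pα qα 0 (suc q) (inj₂ refl))

-- Soundness: what an argument of base ≤ k can reach below ω².

-- ω·p + q is a possible bottom, at base ≤ k, for the top ω·p′ + q′
Reachable : ℕ → ℕ → ℕ → ℕ → ℕ → Set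
Reachable k p q p′ q′ = (p ≡ p′ × q ≤ q′) ⊎ (p < p′ × q ≤ suc k)

reach-trans : ∀ {k p q p₁ q₁ p′ q′} →
              Reachable k p q p₁ q₁ → Reachable k p₁ q₁ p′ q′ → Reachable k p q p′ q′
reach-trans (inj₁ (refl , q≤q₁)) (inj₁ (refl , q₁≤q′)) = inj₁ (refl , ≤-trans q≤q₁ q₁≤q′)
reach-trans (inj₁ (refl , q≤q₁)) (inj₂ (p<p′ , q₁≤k+1)) = inj₂ (p<p′ , ≤-trans q≤q₁ q₁≤k+1)
reach-trans (inj₂ (p<p₁ , q≤k+1)) (inj₁ (refl , _)) = inj₂ (p<p₁ , q≤k+1)
reach-trans (inj₂ (p<p₁ , q≤k+1)) (inj₂ (p₁<p′ , _)) = inj₂ (<-trans p<p₁ p₁<p′ , q≤k+1)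

reach-finite : ∀ {k p q q′} → Reachable k p q 0 q′ → p ≡ 0 × q ≤ q′
reach-finite (inj₁ (refl , q≤q′)) = refl , q≤q′

reach-shift : ∀ {k} pα qα {p q pb qb} → (qα ≡ 0 ⊎ pb ≡ 0) →
              Reachable k p q pb qb → Reachable k (pα + p) (qα + q) (pα + pb) (qα + qb)
reach-shift pα _ (inj₁ refl) (inj₁ (refl , q≤qb)) = inj₁ (refl , q≤qb)
reach-shift pα _ (inj₁ refl) (inj₂ (p<pb , q≤k+1)) = inj₂ (+-monoʳ-< pα p<pb , q≤k+1)
reach-shift pα qα (inj₂ refl) r with reach-finite r
... | refl , q≤qb = inj₁ (refl , +-monoʳ-≤ qα q≤qb)

<O-one : ∀ a → a <O one → a ≡ 𝟎
<O-one 𝟎 _ = refl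
<O-one (ω^ 𝟎 + y) y<𝟎 = ⊥-elim (≮𝟎 y y<𝟎)

finite-meshes-no-ω : ∀ {α′ d} → IsNF (ω^ 𝟎 + α′) → ¬ Meshes (ω^ 𝟎 + α′) (ω^ one + d)
finite-meshes-no-ω {α′} {d} nf m with nf-finite nf
... | n , e =
  ≮𝟎 d (subst (λ z → (ω^ one + d) <O ωexp (z ⊕ one)) (trans (cong minExp e) (minExp-natO n)) m)

⊕-cons : ∀ {a α′ b p′ q′} → IsNF (ω^ a + α′) → Meshes (ω^ a + α′) b →
         (ω^ a + α′) ⊕ b ≡ cnf² p′ q′ → (ω^ a + α′) ⊕ b ≡ ω^ a + (α′ ⊕ b)
⊕-cons {α′ = α′} {𝟎} _ _ _ = cong (ω^ _ +_) (sym (⊕-identityʳ α′))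
⊕-cons {a} {α′} {ω^ c + d} {p′} {q′} nf m e =
  trans (⊕-ω a α′ c d) (go (cmp a c) {p′} {q′} refl (trans (sym (⊕-ω a α′ c d)) e))
  where
  go : ∀ r {p′ q′} → cmp a c ≡ r → consAdd r a α′ c d ≡ cnf² p′ q′ →
       consAdd r a α′ c d ≡ ω^ a + (α′ ⊕ (ω^ c + d))
  go lt {p′} {q′} a<c e′ with consView {c} {d} {p′} {q′} e′
  ... | ω-term _ rewrite <O-one a a<c = ⊥-elim (finite-meshes-no-ω nf m)
  ... | 1-term _ = ⊥-elim (≮𝟎 a a<c)
  go eq _ _ = refl
  go gt _ _ = refl

record Split (α b : Ord) (p′ q′ : ℕ) : Set where
  field
    pα qα pb qb : ℕ
    α≡ : α ≡ cnf² pα qα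
    b≡ : b ≡ cnf² pb qb
    p′≡ : p′ ≡ pα + pb
    q′≡ : q′ ≡ qα + qb
    no-absorb : qα ≡ 0 ⊎ pb ≡ 0

split : ∀ {α b p′ q′} → IsNF α → Meshes α b → α ⊕ b ≡ cnf² p′ q′ → Split α b p′ q′
split {𝟎} {p′ = p′} {q′} _ _ e =
  record { pα = 0 ; qα = 0 ; pb = p′ ; qb = q′ ; α≡ = refl ; b≡ = e
         ; p′≡ = refl ; q′≡ = refl ; no-absorb = inj₁ refl }
split {ω^ a + α′} {b} {p′} {q′} nf@(nfω _ nα′ _) m e
  with consView {a} {α′ ⊕ b} {p′} {q′} (trans (sym (⊕-cons {p′ = p′} {q′} nf m e)) e)
... | ω-term {p = p″} X≡ =
  let open Split (split {p′ = p″} {q′} nα′ (meshes-tail m) X≡) in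
  record { pα = suc pα ; qα = qα ; pb = pb ; qb = qb ; α≡ = cong (ω^ one +_) α≡ ; b≡ = b≡
         ; p′≡ = cong suc p′≡ ; q′≡ = q′≡ ; no-absorb = no-absorb }
... | 1-term {q = q″} X≡ =
  let open Split (split {p′ = 0} {q″} nα′ (meshes-tail m) X≡)
      pα≡0 = m+n≡0⇒m≡0 pα (sym p′≡)
      pb≡0 = m+n≡0⇒n≡0 pα (sym p′≡)
  in
  record { pα = 0 ; qα = suc qα ; pb = pb ; qb = qb
         ; α≡ = cong (ω^ 𝟎 +_) (trans α≡ (cong (λ z → cnf² z qα) pα≡0)) ; b≡ = b≡
         ; p′≡ = sym pb≡0 ; q′≡ = cong suc q′≡ ; no-absorb = inj₂ pb≡0 }

record Bottom (k : ℕ) (x : Ord) (p′ q′ : ℕ) : Set where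
  constructor bottom
  field
    p q : ℕ
    x≡ : x ≡ cnf² p q
    reach : Reachable k p q p′ q′

omega-bottom₀ : ∀ {k a} → Bottom k a 0 0 → Bottom k (ωexp a) 0 1
omega-bottom₀ (bottom _ _ a≡ r) with reach-finite r
... | refl , z≤n = bottom 0 1 (cong ωexp a≡) (inj₁ (refl , ≤-refl))

omega-bottom₁ : ∀ {k a} → Bottom k a 0 1 → Bottom k (ωexp a) 1 0
omega-bottom₁ (bottom _ _ a≡ r) with reach-finite r
... | refl , z≤n = bottom 0 1 (cong ωexp a≡) (inj₂ (≤-refl , s≤s z≤n))
... | refl , s≤s z≤n = bottom 1 0 (cong ωexp a≡) (inj₁ (refl , z≤n))

-- soundness, by induction on the argument: only fund(m) at a limit top moves
-- to a smaller p, and then the new finite part is m + 1 ≤ k + 1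
sound : ∀ {x y k p′ q′} (s : Arg x y) → base s ≤ k → y ≡ cnf² p′ q′ → Bottom k x p′ q′
sound {p′ = zero} {zero} (fund m _ _) _ refl = bottom 0 0 refl (inj₁ (refl , z≤n))
sound {p′ = p′} {suc q} (fund m _ _) _ refl =
  bottom p′ q (fs-cnf²-succ p′ q m) (inj₁ (refl , n≤1+n q))
sound {p′ = suc p} {zero} (fund m _ _) m≤k refl =
  bottom p (suc m) (fs-cnf²-limit p m) (inj₂ (≤-refl , s≤s m≤k))
sound (s ∗ t) bst e with sound t (m⊔n≤o⇒n≤o (base s) (base t) bst) e
... | bottom _ _ b≡ r₂ with sound s (m⊔n≤o⇒m≤o (base s) (base t) bst) b≡
...   | bottom p q a≡ r₁ = bottom p q a≡ (reach-trans r₁ r₂)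
sound {p′ = p′} {q′} (plus α nα m s) bs e with split {p′ = p′} {q′} nα m e
... | record { pα = pα ; qα = qα ; α≡ = α≡ ; b≡ = b≡ ; p′≡ = refl ; q′≡ = refl ; no-absorb = na }
  with sound s bs b≡
...   | bottom p q a≡ r =
  bottom (pα + p) (qα + q) (trans (cong₂ _⊕_ α≡ a≡) (cnf²-+ pα qα p q (still-no-absorb na)))
         (reach-shift pα qα na r)
  where
  still-no-absorb : qα ≡ 0 ⊎ _ ≡ 0 → qα ≡ 0 ⊎ p ≡ 0
  still-no-absorb (inj₁ qα≡0) = inj₁ qα≡0
  still-no-absorb (inj₂ refl) = inj₂ (proj₁ (reach-finite r))
sound {p′ = p′} {q′} (omega {b = b} s) bs e with consView {b} {𝟎} {p′} {q′} e
... | ω-term {p = p″} X≡ with cnf²-injective {0} {0} {p″} {q′} X≡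
...   | refl , refl = omega-bottom₁ (sound s bs refl)
sound (omega s) bs e | 1-term {q = q″} X≡ with natO-injective {0} {q″} X≡
... | refl = omega-bottom₀ (sound s bs refl)

reachable : ∀ {x k p q p′ q′} → x ≡ cnf² p q → x ⊢≤[ k ] cnf² p′ q′ → Reachable k p q p′ q′
reachable {p = p} {q} {p′} {q′} x≡ (s , bs) with sound {p′ = p′} {q′} s bs refl
... | bottom p₀ q₀ x≡′ r with cnf²-injective {p} {q} {p₀} {q₀} (trans (sym x≡) x≡′)
...   | refl , refl = r

-- Part (c): reaching 3^(ω·p′+q′) = ω^p′·3^q′.

3^>0 : ∀ n → 1 ≤ 3 ^ n
3^>0 = m^n>0 3

3^suc : ∀ n → 3 ^ suc n ≡ 3 ^ n + 3 ^ n + 3 ^ n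
3^suc n = sym (trans (+-assoc T T T) (cong (λ z → T + (T + z)) (sym (+-identityʳ T))))
  where T = 3 ^ n

double<3^ : ∀ {q q′} → q < q′ → 3 ^ q + 3 ^ q < 3 ^ q′
double<3^ {q} q<q′ =
  ≤-trans (subst (3 ^ q + 3 ^ q <_) (sym (3^suc q)) (m<m+n (3 ^ q + 3 ^ q) (3^>0 q)))
          (^-monoʳ-≤ 3 q<q′)

2+3^<3^ : ∀ {q q′} → q < q′ → 2 + 3 ^ q ≤ 3 ^ q′
2+3^<3^ {q} q<q′ =
  ≤-trans (subst (2 + 3 ^ q ≤_) (sym (3^suc q)) (+-monoˡ-≤ (3 ^ q) (+-mono-≤ (3^>0 q) (3^>0 q))))
          (^-monoʳ-≤ 3 q<q′)

double≤3^suc : ∀ {q k} → q ≤ k → 3 ^ q + 3 ^ q ≤ 3 ^ suc k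
double≤3^suc {q} {k} q≤k =
  ≤-trans (+-mono-≤ (^-monoʳ-≤ 3 q≤k) (^-monoʳ-≤ 3 q≤k))
          (subst (3 ^ k + 3 ^ k ≤_) (sym (3^suc k)) (m≤m+n (3 ^ k + 3 ^ k) (3 ^ k)))

-- from ω^p·(m+1) to ω^p′·3^q′: inside the block ω^p when p = p′, otherwise by
-- the fundamental step  ω^p·(m+1) ≤_m ω^(p+1) ≤ ω^p′ ≤ ω^p′·3^q′
climb : ∀ {p p′ q′ m K} → (p ≡ p′ × suc m ≤ 3 ^ q′) ⊎ (p < p′ × m ≤ K) →
        ωmul (natO p) (suc m) ⊢≤[ K ] 3^ p′ q′
climb {p} (inj₁ (refl , m<3^q′)) = weaken z≤n (ωmul≤ (natO p) (nf-natO p) m<3^q′)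
climb {p} {p′} {q′} {m} (inj₂ (p<p′ , m≤K)) =
  weaken m≤K (≡-top (cong ωexp (succ-cnf² 0 p)) (fund-ω^succ (natO p) m (nf-natO p)))
  ⨾ weaken z≤n (omega≤ (natO≤ p<p′) ⨾ ωmul≤ (natO p′) (nf-natO p′) (3^>0 q′))

plus-one-goal : ∀ {k p q p′ q′} n → n ≤ 3 ^ q + 3 ^ q → Reachable k p (suc q) p′ q′ →
                ωmul (natO p) n ⊕ one ⊢≤[ 3 ^ suc k ] 3^ p′ q′
plus-one-goal {k} {p} {q} {p′} {q′} n n≤ r =
  weaken z≤n (ωmul-+one (natO p) n (nf-natO p)) ⨾ climb {p′ = p′} {q′} (condition r)
  where
  condition : Reachable k p (suc q) p′ q′ → (p ≡ p′ × suc n ≤ 3 ^ q′) ⊎ (p < p′ × n ≤ 3 ^ suc k)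
  condition (inj₁ (p≡p′ , q<q′)) = inj₁ (p≡p′ , ≤-trans (s≤s n≤) (double<3^ q<q′))
  condition (inj₂ (p<p′ , s≤s q≤k)) = inj₂ (p<p′ , ≤-trans n≤ (double≤3^suc q≤k))

plus-two-goal : ∀ {k p q p′ q′} → Reachable k p (suc (suc q)) p′ q′ →
                ωmul (natO p) (3 ^ q) ⊕ two ⊢≤[ 3 ^ suc k ] 3^ p′ q′
plus-two-goal {k} {p} {q} {p′} {q′} r =
  weaken (3^>0 (suc k)) (ωmul-+two (natO p) (3 ^ q) (nf-natO p))
  ⨾ climb {p′ = p′} {q′} (condition r)
  where
  condition : Reachable k p (suc (suc q)) p′ q′ →
              (p ≡ p′ × suc (suc (3 ^ q)) ≤ 3 ^ q′) ⊎ (p < p′ × suc (3 ^ q) ≤ 3 ^ suc k)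
  condition (inj₁ (p≡p′ , q+1<q′)) = inj₁ (p≡p′ , 2+3^<3^ (≤-trans (n≤1+n _) q+1<q′))
  condition (inj₂ (p<p′ , s≤s q<k)) =
    inj₂ (p<p′ , ≤-trans (+-monoˡ-≤ (3 ^ q) (3^>0 q)) (double≤3^suc (≤-trans (n≤1+n q) q<k)))

-- (c), the claims with +1: by soundness the hypothesis means that
-- ω·p+q+1 is reachable from ω·p′+q′
c-plus-one : ∀ p q p′ q′ k → ωpq p q ⊕ one ⊢≤[ k ] ωpq p′ q′ →
             (×2 (3^ p q) ⊕ one ⊢≤[ 3 ^ suc k ] 3^ p′ q′) × (3^ p q ⊕ one ⊢≤[ 3 ^ suc k ] 3^ p′ q′)
c-plus-one p q p′ q′ k d =
  ≡-bot (cong (_⊕ one) (sym (ωmul-+ (natO p) T T))) (plus-one-goal (T + T) ≤-refl r)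
  , plus-one-goal T (m≤m+n T T) r
  where
  T = 3 ^ q
  bottom≡ : ωpq p q ⊕ one ≡ cnf² p (suc q)
  bottom≡ = trans (cong (_⊕ one) (ωpq≡cnf² p q)) (trans (⊕-one _) (succ-cnf² p q))
  r : Reachable k p (suc q) p′ q′
  r = reachable bottom≡ (≡-top (ωpq≡cnf² p′ q′) d)

c-plus-two : ∀ p q p′ q′ k → ωpq p q ⊕ two ⊢≤[ k ] ωpq p′ q′ → 3^ p q ⊕ two ⊢≤[ 3 ^ suc k ] 3^ p′ q′
c-plus-two p q p′ q′ k d =
  plus-two-goal {k} {p} {q} {p′} {q′} (reachable bottom≡ (≡-top (ωpq≡cnf² p′ q′) d))
  where
  bottom≡ : ωpq p q ⊕ two ≡ cnf² p (suc (suc q))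
  bottom≡ = trans (cong (_⊕ two) (ωpq≡cnf² p q))
                  (trans (⊕-two _) (trans (cong succ (succ-cnf² p q)) (succ-cnf² p (suc q))))

lemma2p3 :
    -- (a)
    ((α : Ord) → IsNF α → α ⊢≤[ 0 ] α)
    ×
    -- (b)
    ((α : Ord) → IsNF α →
        (𝟎 ⊢≤[ 0 ] α)
      × (one ≤O α → one ⊢≤[ 0 ] α)
      × (two ≤O α → two ⊢≤[ 1 ] α))
    ×
    -- (c)  α = ω·p+q , β = ω·p'+q'  (all ordinals < ω²)
    ((p q p' q' k : ℕ) →
        ((ωpq p q ⊕ one ⊢≤[ k ] ωpq p' q' →
            (×2 (3^ p q) ⊕ one ⊢≤[ 3 ^ suc k ] 3^ p' q')
          × (3^ p q ⊕ one ⊢≤[ 3 ^ suc k ] 3^ p' q'))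
        × (ωpq p q ⊕ two ⊢≤[ k ] ωpq p' q' →
            3^ p q ⊕ two ⊢≤[ 3 ^ suc k ] 3^ p' q')))
    ×
    -- (d)
    ((α β : Ord) → IsNF α → IsNF β → (k : ℕ) → 2 ≤ k →
        ((α ⊕ one ⊢≤[ k ] β →
            (×2 (ωexp α) ⊕ one ⊢≤[ k ] ωexp β)
          × (ωexp α ⊕ one ⊢≤[ k ] ωexp β))
        × (α ⊕ two ⊢≤[ k ] β →
            ωexp α ⊕ two ⊢≤[ k ] ωexp β)))
lemma2p3 =
  refl≤
  , (λ α nα → zero≤ α nα , one≤ α nα , two≤ α nα)
  , (λ p q p′ q′ k → c-plus-one p q p′ q′ k , c-plus-two p q p′ q′ k)
  , (λ α _ nα _ k 2≤k →
      (λ d → ≡-bot (cong (_⊕ one) (sym (ωmul-+ α 1 1))) (ω^·n+one≤ 2 nα 2≤k d)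
           , ω^·n+one≤ 1 nα (≤-trans (s≤s z≤n) 2≤k) d)
      , ω^+two≤ nα 2≤k)
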